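{- Let $q \in \mathbf{k}$, let $\pi \in S_n$ and $\sigma \in S_m$ be two permutations, and let $\alpha = (\alpha_1,\dots,\alpha_n)$ and $\beta = (\beta_1,\dots,\beta_m)$ be two compositions with $n$ and $m$ entries. Then the product of the two $q$-universal quasisymmetric functions is \[ U^q_{\pi,\alpha}\,U^q_{\sigma,\beta}=\sum_{(\tau,\gamma)\in \mathrm{Cosh}\big((\pi,\alpha),(\sigma,\beta)\big)}U^q_{\tau,\gamma}, \] where $\mathrm{Cosh}\big((\pi,\alpha),(\sigma,\beta)\big)$ denotes the coshuffle of $(\pi,\alpha)$ and $(\sigma,\beta)$ (written $(\pi,\alpha)\sqcup\!\sqcup(\sigma,\beta)$ with the shuffle symbol in the paper).
   Context: Let $\mathbf{k}$ be a commutative ring and $X=\{x_1,x_2,\dots\}$ indeterminates. Let $\mathbb{P}^{\pm}$ be the set of nonzero integers, totally ordered by $-1<1<-2<2<-3<3<\cdots$. For a partial order $<_P$ on $[n]$, an enriched $P$-partition is a map $f:[n]\to\mathbb{P}^{\pm}$ such that: if $i<_P j$ and $i<j$ then $f(i)<f(j)$ or $f(i)=f(j)>0$; if $i<_P j$ and $i>j$ then $f(i)<f(j)$ or $f(i)=f(j)<0$. For a weight function $\epsilon:[n]\to\mathbb{P}$ and $q\in\mathbf{k}$, set $\Gamma_q([n],<_P,\epsilon)=\sum_{f}\prod_{i=1}^n q^{[f(i)<0]}x_{|f(i)|}^{\epsilon(i)}$, summed over enriched $P$-partitions $f$. For $\pi=\pi_1\cdots\pi_n\in S_n$ and a composition $\alpha$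 with $n$ entries, let $<_\pi$ be the chain order with $\pi_i<_\pi\pi_j$ iff $i<j$, and the weight of vertex $\pi_i$ be $\alpha_i$; the $q$-universal quasisymmetric function is $U^q_{\pi,\alpha}=\Gamma_q([n],<_\pi,\alpha)$. The coshuffle of $(\pi,\alpha)$ and $(\sigma,\beta)$ is the set of pairs $(\tau,\gamma)$ where $\tau\in S_{n+m}$ is a shuffle of the words $\pi$ and $n+\sigma=(n+\sigma_1,\dots,n+\sigma_m)$, and $\gamma$ is the composition with $n+m$ entries obtained by shuffling the entries of $\alpha$ and $\beta$ using the same shuffle used to build $\tau$. Example: $(1\,3\,2,(2,1,2))$ is a coshuffle of $(12,(2,2))$ and $(1,(1))$. -}

module Defs where

open import Level using (Level)
open import Algebra.Bundles using (CommutativeRing)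
open import Data.Nat as ℕ using (ℕ; zero; suc; _+_; _*_; _∸_)
open import Data.Nat.Properties using (+-suc)
open import Data.Bool using (Bool; true; false; if_then_else_)
import Data.Bool.Properties as BoolP
open import Data.Fin as Fin using (Fin; zero; suc; toℕ; join; splitAt)
import Data.Fin.Properties as FinP
open import Data.Fin.Permutation using (Permutation; Permutation′; permutation; _⟨$⟩ʳ_; _⟨$⟩ˡ_)
open import Data.Vec as Vec using (Vec; []; _∷_)
import Data.Vec.Properties as VecP
import Data.Vec.Functional as VF
open import Data.List as List using (List; []; _∷_; _++_)
open import Data.Product using (_×_; _,_; proj₁; proj₂)
import Data.Product.Properties as ProdP
open import Data.Sum as Sum using (_⊎_; inj₁; inj₂; [_,_]′)
open import Data.Sum.Function.Propositional using (_⊎-↔_)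
open import Function using (_∘_; id; _↔_; mk↔ₛ′)
open import Function.Construct.Composition using (_↔-∘_)
open import Function.Construct.Symmetry using (↔-sym)
open import Relation.Binary.PropositionalEquality using (_≡_; refl; sym; cong; subst)
open import Relation.Nullary using (Dec; yes; no; does)
open import Relation.Nullary.Decidable using (_×-dec_; _⊎-dec_; _→-dec_)

allFuns : {A : Set} → List A → (n : ℕ) → List (Fin n → A)
allFuns as zero = (λ ()) ∷ []
allFuns as (suc n) = List.concatMap (λ a → List.map (λ g → a VF.∷ g) (allFuns as n)) as

sumFinℕ : (n : ℕ) → (Fin n → ℕ) → ℕ
sumFinℕ zero f = 0
sumFinℕ (suc n) f = f zero + sumFinℕ n (f ∘ suc)

splits : {N : ℕ} → Vec ℕ N → List (Vec ℕ N × Vec ℕ N)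
splits [] = ([] , []) ∷ []
splits (k ∷ e) =
  List.concatMap (λ i → List.map (λ p → (i ∷ proj₁ p , (k ∸ i) ∷ proj₂ p)) (splits e))
                 (List.upTo (suc k))

-- Signed integers ℙ^± restricted to absolute value ≤ N.
-- (k , s) : Fin N × Bool represents  -(k+1)  if s = true,  +(k+1)  if s = false.

SV : ℕ → Set
SV N = Fin N × Bool

allSV : (N : ℕ) → List (SV N)
allSV N = List.cartesianProduct (List.allFin N) (true ∷ false ∷ [])

-- position in the total order  -1 < 1 < -2 < 2 < ...
key : {N : ℕ} → SV N → ℕ
key (k , true)  = 2 * toℕ k
key (k , false) = suc (2 * toℕ k)

_<±_ : {N : ℕ} → SV N → SV N → Set
a <± b = key a ℕ.< key b

_≟SV_ : {N : ℕ} → (a b : SV N) → Dec (a ≡ b)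
_≟SV_ = ProdP.≡-dec FinP._≟_ BoolP._≟_

isNeg : {N : ℕ} → SV N → Bool
isNeg = proj₂

module _ {n N : ℕ} (_<P_ : Fin n → Fin n → Set) where

  EnrichedCond : (f : Fin n → SV N) → Fin n → Fin n → Set
  EnrichedCond f i j =
    i <P j →
      ((i Fin.< j → (f i <± f j) ⊎ ((f i ≡ f j) × (isNeg (f i) ≡ false)))
     × (j Fin.< i → (f i <± f j) ⊎ ((f i ≡ f j) × (isNeg (f i) ≡ true))))

  IsEnriched : (f : Fin n → SV N) → Set
  IsEnriched f = ∀ i j → EnrichedCond f i j

  isEnriched? : (∀ i j → Dec (i <P j)) → (f : Fin n → SV N) → Dec (IsEnriched f)
  isEnriched? _<P?_ f = FinP.all? λ i → FinP.all? λ j →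
    (i <P? j) →-dec
      ( ((i FinP.<? j) →-dec ((key (f i) ℕ.<? key (f j)) ⊎-dec ((f i ≟SV f j) ×-dec (isNeg (f i) BoolP.≟ false))))
      ×-dec ((j FinP.<? i) →-dec ((key (f i) ℕ.<? key (f j)) ⊎-dec ((f i ≟SV f j) ×-dec (isNeg (f i) BoolP.≟ true)))))

-- Formal power series in x₁, x₂, … over a commutative ring, given by their
-- coefficients: the coefficient of the monomial x₁^{e₁} ⋯ x_N^{e_N}
-- (all other exponents 0) for every N and every e : Vec ℕ N.

module _ {c ℓ : Level} (R : CommutativeRing c ℓ) where
  open CommutativeRing R using (Carrier; 0#; 1#) renaming (_+_ to _+R_; _*_ to _*R_)

  Series : Set c
  Series = (N : ℕ) → Vec ℕ N → Carrier

  sumR : List Carrier → Carrier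
  sumR = List.foldr _+R_ 0#

  powR : Carrier → ℕ → Carrier
  powR q zero = 1#
  powR q (suc k) = q *R powR q k

  _·S_ : Series → Series → Series
  (F ·S G) N e = sumR (List.map (λ p → F N (proj₁ p) *R G N (proj₂ p)) (splits e))

  expo : {n N : ℕ} → (Fin n → ℕ) → (Fin n → SV N) → Vec ℕ N
  expo {n} ε f = Vec.tabulate λ k →
    sumFinℕ n (λ i → if does (proj₁ (f i) FinP.≟ k) then ε i else 0)

  negCount : {n N : ℕ} → (Fin n → SV N) → ℕ
  negCount {n} f = sumFinℕ n (λ i → if isNeg (f i) then 1 else 0)

  -- Γ_q([n], <_P, ε) = Σ_f ∏_i q^{[f(i)<0]} x_{|f(i)|}^{ε(i)}, summed over
  -- enriched P-partitions f.  Coefficient of x^e with e : Vec ℕ N: since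
  -- ε(i) ≥ 1, only f with |f(i)| ≤ N can contribute, and these are enumerated.
  Γq : (q : Carrier) {n : ℕ} (_<P_ : Fin n → Fin n → Set) →
       (∀ i j → Dec (i <P j)) → (ε : Fin n → ℕ) → Series
  Γq q {n} _<P_ _<P?_ ε N e =
    sumR (List.map (λ f → if does (isEnriched? _<P_ _<P?_ f)
                             ∧′ does (VecP.≡-dec ℕ._≟_ (expo ε f) e)
                          then powR q (negCount f) else 0#)
                   (allFuns (allSV N) n))
    where
    _∧′_ : Bool → Bool → Bool
    true ∧′ b = b
    false ∧′ b = false

-- Chain order of a permutation π = π₁⋯πₙ (π ⟨$⟩ʳ i = π_{i+1}):
-- πᵢ <_π πⱼ iff i < j.

_<[_]_ : {n : ℕ} → Fin n → Permutation′ n → Fin n → Set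
a <[ π ] b = (π ⟨$⟩ˡ a) Fin.< (π ⟨$⟩ˡ b)

<[]? : {n : ℕ} (π : Permutation′ n) → ∀ a b → Dec (a <[ π ] b)
<[]? π a b = (π ⟨$⟩ˡ a) FinP.<? (π ⟨$⟩ˡ b)

-- q-universal quasisymmetric function U^q_{π,α}: vertex πᵢ has weight αᵢ
U : {c ℓ : Level} (R : CommutativeRing c ℓ) → CommutativeRing.Carrier R →
    {n : ℕ} → Permutation′ n → (Fin n → ℕ) → Series R
U R q {n} π α = Γq R q (λ a b → a <[ π ] b) (<[]? π) (λ a → α (π ⟨$⟩ˡ a))

-- A value of  Shuffle n m k  is a word of length k made of
-- n letters L and m letters R; position p of the word carries the
-- (p-th occurrence-numbered) letter  pos s p : Fin n ⊎ Fin m.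

data Shuffle : ℕ → ℕ → ℕ → Set where
  done  : Shuffle 0 0 0
  left  : ∀ {n m k} → Shuffle n m k → Shuffle (suc n) m (suc k)
  right : ∀ {n m k} → Shuffle n m k → Shuffle n (suc m) (suc k)

pos : ∀ {n m k} → Shuffle n m k → Fin k → Fin n ⊎ Fin m
pos (left s)  zero    = inj₁ zero
pos (left s)  (suc p) = Sum.map₁ suc (pos s p)
pos (right s) zero    = inj₂ zero
pos (right s) (suc p) = Sum.map₂ suc (pos s p)

unpos : ∀ {n m k} → Shuffle n m k → Fin n ⊎ Fin m → Fin k
unpos (left s)  (inj₁ zero)    = zero
unpos (left s)  (inj₁ (suc r)) = suc (unpos s (inj₁ r))
unpos (left s)  (inj₂ r)       = suc (unpos s (inj₂ r))
unpos (right s) (inj₁ r)       = suc (unpos s (inj₁ r))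
unpos (right s) (inj₂ zero)    = zero
unpos (right s) (inj₂ (suc r)) = suc (unpos s (inj₂ r))

pos-unpos : ∀ {n m k} (s : Shuffle n m k) x → pos s (unpos s x) ≡ x
pos-unpos (left s)  (inj₁ zero)    = refl
pos-unpos (left s)  (inj₁ (suc r)) = cong (Sum.map₁ suc) (pos-unpos s (inj₁ r))
pos-unpos (left s)  (inj₂ r)       = cong (Sum.map₁ suc) (pos-unpos s (inj₂ r))
pos-unpos (right s) (inj₁ r)       = cong (Sum.map₂ suc) (pos-unpos s (inj₁ r))
pos-unpos (right s) (inj₂ zero)    = refl
pos-unpos (right s) (inj₂ (suc r)) = cong (Sum.map₂ suc) (pos-unpos s (inj₂ r))

unpos-pos : ∀ {n m k} (s : Shuffle n m k) p → unpos s (pos s p) ≡ p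
unpos-pos (left s) zero = refl
unpos-pos (left s) (suc p) with pos s p | unpos-pos s p
... | inj₁ r | eq = cong suc eq
... | inj₂ r | eq = cong suc eq
unpos-pos (right s) zero = refl
unpos-pos (right s) (suc p) with pos s p | unpos-pos s p
... | inj₁ r | eq = cong suc eq
... | inj₂ r | eq = cong suc eq

shuffle↔ : ∀ {n m k} → Shuffle n m k → Fin k ↔ (Fin n ⊎ Fin m)
shuffle↔ s = mk↔ₛ′ (pos s) (unpos s) (pos-unpos s) (unpos-pos s)

allShuffles : (n m : ℕ) → List (Shuffle n m (n + m))
allShuffles zero zero = done ∷ []
allShuffles (suc n) zero = List.map left (allShuffles n zero)
allShuffles zero (suc m) = List.map right (allShuffles zero m)
allShuffles (suc n) (suc m) =
  List.map left (allShuffles n (suc m)) ++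
  List.map (λ s → subst (Shuffle (suc n) (suc m)) (sym (cong suc (+-suc n m))) (right s))
           (allShuffles (suc n) m)

-- Coshuffle of (π, α) and (σ, β): for each shuffle s, the permutation
-- τ with τ_p = π_r if position p carries the r-th letter of π, and
-- τ_p = n + σ_r if it carries the r-th letter of σ; the composition γ
-- with γ_p = α_r resp. β_r.

coshufflePerm : ∀ {n m} → Permutation′ n → Permutation′ m →
                Shuffle n m (n + m) → Permutation′ (n + m)
coshufflePerm {n} {m} π σ s = ↔-sym (FinP.+↔⊎ {n} {m}) ↔-∘ ((π ⊎-↔ σ) ↔-∘ shuffle↔ s)

coshuffleComp : ∀ {n m} → (Fin n → ℕ) → (Fin m → ℕ) →
                Shuffle n m (n + m) → (Fin (n + m) → ℕ)
coshuffleComp α β s p = [ α , β ]′ (pos s p)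

Coshuffle : ∀ {n m} → Permutation′ n → (Fin n → ℕ) → Permutation′ m → (Fin m → ℕ) →
            List (Permutation′ (n + m) × (Fin (n + m) → ℕ))
Coshuffle {n} {m} π α σ β =
  List.map (λ s → coshufflePerm π σ s , coshuffleComp α β s) (allShuffles n m)

-- Coefficientwise, both sides expand into sums over pairs (f , g) of signed labellings of
-- the chains π and σ; on the left such a pair counts exactly when f and g are enriched.  On the right, a
-- labelling of a coshuffle chain τ is a concatenation f ++ g, and it is enriched for τ exactly when f
-- and g are enriched and the shuffle is compatible with the values: each letter of π must be ≼⁺ every
-- later letter of σ, and each letter of σ must be ≼⁻ every later letter of π.  Enriched labellings read
-- along a chain are weakly increasing for −1 < 1 < −2 < 2 < ⋯, and for any two values u and v exactly one
-- of u ≼⁺ v and v ≼⁻ u holds, so exactly one shuffle is compatible (the merge of the two sorted words)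
-- and every pair is counted once on each side.
module Submission where

open import Defs
open import Level using (Level)
open import Algebra.Bundles using (CommutativeRing; CommutativeMonoid)
open import Data.Nat as ℕ using (ℕ; zero; suc; _+_; _∸_; _<_)
import Data.Nat.Properties as ℕP
import Data.Bool.Properties as BoolP
open import Algebra.Properties.CommutativeSemigroup (CommutativeMonoid.commutativeSemigroup BoolP.∧-commutativeMonoid)
  using () renaming (interchange to ∧-interchange)
open import Data.Bool using (Bool; true; false; if_then_else_; _∧_; not)
open import Data.Fin as Fin using (Fin; zero; suc; splitAt; join; _↑ˡ_; _↑ʳ_)
import Data.Fin.Properties as FinP
import Data.Vec.Functional as VF
import Data.Vec.Functional.Properties as VFP
open import Data.Fin.Permutation using (Permutation′; _⟨$⟩ʳ_; _⟨$⟩ˡ_; inverseˡ; inverseʳ)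
open import Data.Vec as Vec using (Vec; []; _∷_)
import Data.Vec.Properties as VecP
open import Data.List as List using (List; []; _∷_; _++_; map)
open import Data.Product using (_×_; _,_; proj₁; proj₂)
open import Data.Sum using (_⊎_; inj₁; inj₂; [_,_]′)
open import Data.Unit using (⊤; tt)
open import Function using (_∘_; id; _⇔_; mk⇔; Equivalence)
open import Relation.Binary.PropositionalEquality as ≡ using (_≡_; _≢_; refl)
open import Relation.Nullary using (Dec; yes; no; does; ¬_; contradiction)
open import Relation.Binary.Definitions using (tri<; tri≈; tri>)
open import Relation.Nullary.Decidable using (_×-dec_; _⊎-dec_; ¬?; dec-true; dec-false; does-⇔)

private variable
  A B : Set
  N n m k : ℕ

infix 4 _≟ᵥ_
infixl 6 _+ᵥ_

_≟ᵥ_ : {N : ℕ} (u v : Vec ℕ N) → Dec (u ≡ v)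
_≟ᵥ_ = VecP.≡-dec ℕ._≟_

_+ᵥ_ : {N : ℕ} → Vec ℕ N → Vec ℕ N → Vec ℕ N
_+ᵥ_ = Vec.zipWith _+_

m<1+o×n≡o∸m⇔m+n≡o : ∀ m n o → (m < suc o × n ≡ o ∸ m) ⇔ (m + n ≡ o)
m<1+o×n≡o∸m⇔m+n≡o m n o = mk⇔
  (λ { (m<1+o , refl) → ℕP.m+[n∸m]≡n (ℕP.m<1+n⇒m≤n m<1+o) })
  (λ { refl → ℕ.s≤s (ℕP.m≤m+n m n) , ≡.sym (ℕP.m+n∸m≡n m n) })

sumFinℕ-cong : ∀ n {F G : Fin n → ℕ} → (∀ i → F i ≡ G i) → sumFinℕ n F ≡ sumFinℕ n G
sumFinℕ-cong zero    F≗G = refl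
sumFinℕ-cong (suc n) F≗G = ≡.cong₂ _+_ (F≗G zero) (sumFinℕ-cong n (F≗G ∘ suc))

sumFinℕ-++ : ∀ n m (F : Fin (n + m) → ℕ) →
             sumFinℕ (n + m) F ≡ sumFinℕ n (F ∘ (_↑ˡ m)) + sumFinℕ m (F ∘ (n ↑ʳ_))
sumFinℕ-++ zero    m F = refl
sumFinℕ-++ (suc n) m F = ≡.trans (≡.cong (F zero +_) (sumFinℕ-++ n m (F ∘ suc))) (≡.sym (ℕP.+-assoc (F zero) _ _))

zipWith-+-tabulate : (P Q : Fin N → ℕ) → Vec.tabulate P +ᵥ Vec.tabulate Q ≡ Vec.tabulate (λ k → P k + Q k)
zipWith-+-tabulate {zero}  P Q = refl
zipWith-+-tabulate {suc N} P Q = ≡.cong (P zero + Q zero ∷_) (zipWith-+-tabulate (P ∘ suc) (Q ∘ suc))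

module Sums {c ℓ : Level} (R : CommutativeRing c ℓ) where
  open CommutativeRing R hiding (zero) renaming (_+_ to _⊕_; _*_ to _⊗_; refl to ≈-refl)
  open import Algebra.Properties.CommutativeSemigroup +-commutativeSemigroup using (interchange)
  open import Relation.Binary.Reasoning.Setoid setoid

  ∑ : List A → (A → Carrier) → Carrier
  ∑ L F = sumR R (map F L)

  syntax ∑ L (λ x → F) = ∑[ x ∈ L ] F

  ∑-cong : (L : List A) {F G : A → Carrier} → (∀ x → F x ≈ G x) → ∑ L F ≈ ∑ L G
  ∑-cong []      F≈G = ≈-refl
  ∑-cong (x ∷ L) F≈G = +-cong (F≈G x) (∑-cong L F≈G)

  ∑-map : (L : List A) (g : A → B) (F : B → Carrier) → ∑ (map g L) F ≡ ∑ L (F ∘ g)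
  ∑-map []      g F = refl
  ∑-map (x ∷ L) g F = ≡.cong (F (g x) ⊕_) (∑-map L g F)

  ∑-++ : (L M : List A) (F : A → Carrier) → ∑ (L ++ M) F ≈ ∑ L F ⊕ ∑ M F
  ∑-++ []      M F = sym (+-identityˡ _)
  ∑-++ (x ∷ L) M F = trans (+-congˡ (∑-++ L M F)) (sym (+-assoc _ _ _))

  ∑-concatMap : (L : List A) (h : A → List B) (F : B → Carrier) →
                ∑ (List.concatMap h L) F ≈ ∑[ a ∈ L ] ∑ (h a) F
  ∑-concatMap []      h F = ≈-refl
  ∑-concatMap (x ∷ L) h F = trans (∑-++ (h x) _ F) (+-congˡ (∑-concatMap L h F))

  ∑-zero : (L : List A) {F : A → Carrier} → (∀ x → F x ≈ 0#) → ∑ L F ≈ 0#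
  ∑-zero []      F≈0 = ≈-refl
  ∑-zero (x ∷ L) F≈0 = trans (+-cong (F≈0 x) (∑-zero L F≈0)) (+-identityˡ 0#)

  ∑-⊕ : (L : List A) (F G : A → Carrier) → ∑[ a ∈ L ] (F a ⊕ G a) ≈ ∑ L F ⊕ ∑ L G
  ∑-⊕ []      F G = sym (+-identityˡ 0#)
  ∑-⊕ (x ∷ L) F G = trans (+-congˡ (∑-⊕ L F G)) (interchange _ _ _ _)

  ∑-distribˡ : (L : List A) (x : Carrier) (F : A → Carrier) → x ⊗ ∑ L F ≈ ∑[ a ∈ L ] (x ⊗ F a)
  ∑-distribˡ []      x F = zeroʳ x
  ∑-distribˡ (y ∷ L) x F = trans (distribˡ x _ _) (+-congˡ (∑-distribˡ L x F))

  ∑-distribʳ : (L : List A) (x : Carrier) (F : A → Carrier) → ∑ L F ⊗ x ≈ ∑[ a ∈ L ] (F a ⊗ x)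
  ∑-distribʳ []      x F = zeroˡ x
  ∑-distribʳ (y ∷ L) x F = trans (distribʳ x _ _) (+-congˡ (∑-distribʳ L x F))

  ∑-comm : (L : List A) (M : List B) (F : A → B → Carrier) →
           ∑[ a ∈ L ] ∑ M (F a) ≈ ∑[ b ∈ M ] ∑[ a ∈ L ] F a b
  ∑-comm []      M F = sym (∑-zero M (λ _ → ≈-refl))
  ∑-comm (x ∷ L) M F = trans (+-congˡ (∑-comm L M F)) (sym (∑-⊕ M (F x) _))

  ∑-allFuns-++ : (as : List A) (n m : ℕ) (F : (Fin (n + m) → A) → Carrier) →
                 (∀ {h h'} → (∀ i → h i ≡ h' i) → F h ≈ F h') →
                 ∑ (allFuns as (n + m)) F ≈ ∑[ f ∈ allFuns as n ] ∑[ g ∈ allFuns as m ] F (f VF.++ g)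
  ∑-allFuns-++ as zero    m F F-resp = sym (+-identityʳ _)
  ∑-allFuns-++ as (suc n) m F F-resp = begin
    ∑ (allFuns as (suc n + m)) F
      ≈⟨ ∑-concatMap as _ F ⟩
    ∑[ a ∈ as ] ∑ (map (a VF.∷_) (allFuns as (n + m))) F
      ≈⟨ ∑-cong as (λ a → reflexive (∑-map (allFuns as (n + m)) (a VF.∷_) F)) ⟩
    ∑[ a ∈ as ] ∑[ h ∈ allFuns as (n + m) ] F (a VF.∷ h)
      ≈⟨ ∑-cong as (λ a → ∑-allFuns-++ as n m (F ∘ (a VF.∷_)) (F-resp ∘ ∷-cong a)) ⟩
    ∑[ a ∈ as ] ∑[ f ∈ allFuns as n ] ∑[ g ∈ allFuns as m ] F (a VF.∷ (f VF.++ g))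
      ≈⟨ ∑-cong as (λ a → ∑-cong (allFuns as n) (λ f → ∑-cong (allFuns as m) (λ g → F-resp (∷-++ a f g)))) ⟩
    ∑[ a ∈ as ] ∑[ f ∈ allFuns as n ] ∑[ g ∈ allFuns as m ] F ((a VF.∷ f) VF.++ g)
      ≈⟨ ∑-cong as (λ a → reflexive (≡.sym (∑-map (allFuns as n) (a VF.∷_) _))) ⟩
    ∑[ a ∈ as ] ∑[ f ∈ map (a VF.∷_) (allFuns as n) ] ∑[ g ∈ allFuns as m ] F (f VF.++ g)
      ≈⟨ sym (∑-concatMap as _ _) ⟩
    ∑[ f ∈ allFuns as (suc n) ] ∑[ g ∈ allFuns as m ] F (f VF.++ g) ∎
    where
    ∷-cong : ∀ {k} a {h h' : Fin k → A} → (∀ i → h i ≡ h' i) → ∀ i → (a VF.∷ h) i ≡ (a VF.∷ h') i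
    ∷-cong a h≗h' zero    = refl
    ∷-cong a h≗h' (suc i) = h≗h' i
    ∷-++ : ∀ a f g i → (a VF.∷ (f VF.++ g)) i ≡ ((a VF.∷ f) VF.++ g) i
    ∷-++ a f g zero = refl
    ∷-++ a f g (suc i) with splitAt n i
    ... | inj₁ _ = refl
    ... | inj₂ _ = refl

  [_]·_ : Bool → Carrier → Carrier
  [ b ]· x = if b then x else 0#

  []·-cong : ∀ b {x y} → x ≈ y → [ b ]· x ≈ [ b ]· y
  []·-cong true  x≈y = x≈y
  []·-cong false x≈y = ≈-refl

  []·-∧ : ∀ b c x → [ b ∧ c ]· x ≡ [ b ]· [ c ]· x
  []·-∧ true  c x = refl
  []·-∧ false c x = refl

  []·-cong-dec : ∀ {p} {P : Set p} (P? : Dec P) {x y} → (P → x ≈ y) → [ does P? ]· x ≈ [ does P? ]· y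
  []·-cong-dec (yes p) x≈y = x≈y p
  []·-cong-dec (no ¬p) x≈y = ≈-refl

  []·-⊗ : ∀ b c x y → [ b ]· x ⊗ [ c ]· y ≈ [ b ∧ c ]· (x ⊗ y)
  []·-⊗ true  true  x y = ≈-refl
  []·-⊗ true  false x y = zeroʳ x
  []·-⊗ false c     x y = zeroˡ _

  ∑-[]· : (L : List A) (b : Bool) (F : A → Carrier) → ∑[ a ∈ L ] [ b ]· F a ≈ [ b ]· ∑ L F
  ∑-[]· L true  F = ≈-refl
  ∑-[]· L false F = ∑-zero L (λ _ → ≈-refl)

  ∑-[]·-∧ : (L : List A) (b : Bool) (c : A → Bool) (x : Carrier) →
            ∑[ a ∈ L ] [ b ∧ c a ]· x ≈ [ b ]· ∑[ a ∈ L ] [ c a ]· x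
  ∑-[]·-∧ L b c x = trans (∑-cong L (λ a → reflexive ([]·-∧ b (c a) x))) (∑-[]· L b _)

  ∑-applyUpTo-zero : (h : ℕ → A) (K : ℕ) (G : A → Carrier) → (∀ i → G (h i) ≈ 0#) →
                     ∑ (List.applyUpTo h K) G ≈ 0#
  ∑-applyUpTo-zero h zero    G G≈0 = ≈-refl
  ∑-applyUpTo-zero h (suc K) G G≈0 =
    trans (+-cong (G≈0 0) (∑-applyUpTo-zero (h ∘ suc) K G (G≈0 ∘ suc))) (+-identityˡ 0#)

  ∑-applyUpTo-single : (h : ℕ → A) (K a : ℕ) (G : A → Carrier) → (∀ i → i ≢ a → G (h i) ≈ 0#) →
                       ∑ (List.applyUpTo h K) G ≈ [ does (a ℕ.<? K) ]· G (h a)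
  ∑-applyUpTo-single h zero    a       G G≈0 = ≈-refl
  ∑-applyUpTo-single h (suc K) zero    G G≈0 =
    trans (+-congˡ (∑-applyUpTo-zero (h ∘ suc) K G (λ i → G≈0 (suc i) λ ()))) (+-identityʳ _)
  ∑-applyUpTo-single h (suc K) (suc a) G G≈0 =
    trans (+-cong (G≈0 0 λ ())
                  (∑-applyUpTo-single (h ∘ suc) K a G (λ i i≢a → G≈0 (suc i) (i≢a ∘ ℕP.suc-injective))))
          (+-identityˡ _)

  ∑-splits : ∀ {N} (e u v : Vec ℕ N) (x : Carrier) →
             ∑[ p ∈ splits e ] [ does (u ≟ᵥ proj₁ p) ∧ does (v ≟ᵥ proj₂ p) ]· x ≈ [ does (u +ᵥ v ≟ᵥ e) ]· x
  ∑-splits []      []      []      x = +-identityʳ x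
  ∑-splits (k ∷ e) (a ∷ u) (b ∷ v) x = begin
    ∑ (splits (k ∷ e)) Φ
      ≈⟨ ∑-concatMap (List.upTo (suc k)) (λ i → map (λ p → i ∷ proj₁ p , (k ∸ i) ∷ proj₂ p) (splits e)) Φ ⟩
    ∑[ i ∈ List.upTo (suc k) ] ∑ (map (λ p → i ∷ proj₁ p , (k ∸ i) ∷ proj₂ p) (splits e)) Φ
      ≈⟨ ∑-cong (List.upTo (suc k)) (λ i → reflexive (∑-map (splits e) _ Φ)) ⟩
    ∑[ i ∈ List.upTo (suc k) ] ∑[ p ∈ splits e ] [ (a≡ i ∧ u≡ p) ∧ (b≡ i ∧ v≡ p) ]· x
      ≈⟨ ∑-cong (List.upTo (suc k)) (λ i → ∑-cong (splits e) (λ p → reflexive (regroup i p))) ⟩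
    ∑[ i ∈ List.upTo (suc k) ] ∑[ p ∈ splits e ] [ a≡ i ∧ b≡ i ]· [ u≡ p ∧ v≡ p ]· x
      ≈⟨ ∑-cong (List.upTo (suc k)) (λ i → ∑-[]· (splits e) (a≡ i ∧ b≡ i) _) ⟩
    ∑[ i ∈ List.upTo (suc k) ] [ a≡ i ∧ b≡ i ]· ∑[ p ∈ splits e ] [ u≡ p ∧ v≡ p ]· x
      ≈⟨ ∑-cong (List.upTo (suc k)) (λ i → []·-cong (a≡ i ∧ b≡ i) (∑-splits e u v x)) ⟩
    ∑[ i ∈ List.upTo (suc k) ] [ a≡ i ∧ b≡ i ]· D
      ≈⟨ ∑-applyUpTo-single (λ i → i) (suc k) a (λ i → [ a≡ i ∧ b≡ i ]· D)
           (λ i i≢a → reflexive (≡.cong (λ t → [ t ∧ b≡ i ]· D) (dec-false (a ℕ.≟ i) (i≢a ∘ ≡.sym)))) ⟩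
    [ does (a ℕ.<? suc k) ]· [ a≡ a ∧ b≡ a ]· D
      ≡⟨ ≡.cong (λ t → [ does (a ℕ.<? suc k) ]· [ t ∧ b≡ a ]· D) (dec-true (a ℕ.≟ a) refl) ⟩
    [ does (a ℕ.<? suc k) ]· [ b≡ a ]· D
      ≡⟨ ≡.sym ([]·-∧ (does (a ℕ.<? suc k)) (b≡ a) D) ⟩
    [ does ((a ℕ.<? suc k) ×-dec (b ℕ.≟ k ∸ a)) ]· D
      ≡⟨ ≡.cong (λ t → [ t ]· D)
           (does-⇔ (m<1+o×n≡o∸m⇔m+n≡o a b k) ((a ℕ.<? suc k) ×-dec (b ℕ.≟ k ∸ a)) (a + b ℕ.≟ k)) ⟩
    [ does (a + b ℕ.≟ k) ]· D
      ≡⟨ ≡.sym ([]·-∧ (does (a + b ℕ.≟ k)) _ x) ⟩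
    [ does ((a ∷ u) +ᵥ (b ∷ v) ≟ᵥ (k ∷ e)) ]· x ∎
    where
    a≡ b≡ : ℕ → Bool
    a≡ i = does (a ℕ.≟ i)
    b≡ i = does (b ℕ.≟ k ∸ i)
    u≡ v≡ : Vec ℕ _ × Vec ℕ _ → Bool
    u≡ p = does (u ≟ᵥ proj₁ p)
    v≡ p = does (v ≟ᵥ proj₂ p)
    Φ : Vec ℕ _ × Vec ℕ _ → Carrier
    Φ p = [ does ((a ∷ u) ≟ᵥ proj₁ p) ∧ does ((b ∷ v) ≟ᵥ proj₂ p) ]· x
    D : Carrier
    D = [ does (u +ᵥ v ≟ᵥ e) ]· x
    regroup : ∀ i p → [ (a≡ i ∧ u≡ p) ∧ (b≡ i ∧ v≡ p) ]· x ≡ [ a≡ i ∧ b≡ i ]· [ u≡ p ∧ v≡ p ]· x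
    regroup i p = ≡.trans (≡.cong (λ t → [ t ]· x) (∧-interchange (a≡ i) (u≡ p) (b≡ i) (v≡ p)))
                          ([]·-∧ (a≡ i ∧ b≡ i) _ x)

infix 4 _≼[_]_ _≼⁺_ _≼⁻_

-- u ≼⁺ v is the paper's "u < v or u = v > 0", and u ≼⁻ v is "u < v or u = v < 0".
_≼[_]_ : SV N → Bool → SV N → Set
u ≼[ b ] v = (u <± v) ⊎ ((u ≡ v) × (isNeg u ≡ b))

_≼⁺_ _≼⁻_ : SV N → SV N → Set
u ≼⁺ v = u ≼[ false ] v
u ≼⁻ v = u ≼[ true ] v

_≼[_]?_ : (u : SV N) (b : Bool) (v : SV N) → Dec (u ≼[ b ] v)
u ≼[ b ]? v = (key u ℕ.<? key v) ⊎-dec ((u ≟SV v) ×-dec (isNeg u BoolP.≟ b))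

key-injective : (u v : SV N) → key u ≡ key v → u ≡ v
key-injective (k , true)  (k' , true)  eq =
  ≡.cong (_, true)  (FinP.toℕ-injective (ℕP.*-cancelˡ-≡ (Fin.toℕ k) (Fin.toℕ k') 2 eq))
key-injective (k , false) (k' , false) eq =
  ≡.cong (_, false) (FinP.toℕ-injective (ℕP.*-cancelˡ-≡ (Fin.toℕ k) (Fin.toℕ k') 2 (ℕP.suc-injective eq)))
key-injective (k , true)  (k' , false) eq = contradiction eq (ℕP.even≢odd (Fin.toℕ k) (Fin.toℕ k'))
key-injective (k , false) (k' , true)  eq = contradiction (≡.sym eq) (ℕP.even≢odd (Fin.toℕ k') (Fin.toℕ k))

≼⇒key≤ : ∀ {u v : SV N} {b} → u ≼[ b ] v → key u ℕ.≤ key v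
≼⇒key≤ (inj₁ u<v)        = ℕP.<⇒≤ u<v
≼⇒key≤ (inj₂ (refl , _)) = ℕP.≤-refl

≼-key≤-trans : ∀ {u v w : SV N} {b} → u ≼[ b ] v → key v ℕ.≤ key w → u ≼[ b ] w
≼-key≤-trans             (inj₁ u<v)           v≤w = inj₁ (ℕP.<-≤-trans u<v v≤w)
≼-key≤-trans {u = u} {w = w} (inj₂ (refl , sign)) u≤w with ℕP.m≤n⇒m<n∨m≡n u≤w
... | inj₁ u<w = inj₁ u<w
... | inj₂ u≡w = inj₂ (key-injective u w u≡w , sign)

≼⁺⇒⋠⁻ : ∀ {u v : SV N} → u ≼⁺ v → ¬ v ≼⁻ u
≼⁺⇒⋠⁻ (inj₁ u<v)        (inj₁ v<u)           = ℕP.<-asym u<v v<u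
≼⁺⇒⋠⁻ (inj₁ u<v)        (inj₂ (refl , _))    = ℕP.<-irrefl refl u<v
≼⁺⇒⋠⁻ (inj₂ (refl , _)) (inj₁ v<u)           = ℕP.<-irrefl refl v<u
≼⁺⇒⋠⁻ (inj₂ (refl , pos)) (inj₂ (_ , neg)) = contradiction (≡.trans (≡.sym pos) neg) λ ()

⋠⁺⇒≼⁻ : ∀ {u v : SV N} → ¬ u ≼⁺ v → v ≼⁻ u
⋠⁺⇒≼⁻ {u = u} {v} u⋠v with ℕP.<-cmp (key u) (key v)
... | tri< u<v _ _ = contradiction (inj₁ u<v) u⋠v
... | tri> _ _ v<u = inj₁ v<u
... | tri≈ _ u≈v _ with refl ← key-injective u v u≈v = ⋠⁺-self⇒≼⁻-self u u⋠v
  where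
  ⋠⁺-self⇒≼⁻-self : (u : SV N) → ¬ u ≼⁺ u → u ≼⁻ u
  ⋠⁺-self⇒≼⁻-self (_ , true)  _    = inj₂ (refl , refl)
  ⋠⁺-self⇒≼⁻-self (_ , false) u⋠u = contradiction (inj₂ (refl , refl)) u⋠u

Sorted : (Fin k → SV N) → Set
Sorted F = ∀ {r r'} → r Fin.< r' → key (F r) ℕ.≤ key (F r')

sorted-tail : {F : Fin (suc k) → SV N} → Sorted F → Sorted (F ∘ suc)
sorted-tail sorted r<r' = sorted (ℕ.s≤s r<r')

sorted-head : {F : Fin (suc k) → SV N} → Sorted F → ∀ r → key (F zero) ℕ.≤ key (F r)
sorted-head sorted zero    = ℕP.≤-refl
sorted-head sorted (suc r) = sorted (ℕ.s≤s ℕ.z≤n)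

Compatible : Shuffle n m k → (Fin n → SV N) → (Fin m → SV N) → Set
Compatible done      F G = ⊤
Compatible (left s)  F G = (∀ r → F zero ≼⁺ G r) × Compatible s (F ∘ suc) G
Compatible (right s) F G = (∀ r → G zero ≼⁻ F r) × Compatible s F (G ∘ suc)

compatible? : (s : Shuffle n m k) (F : Fin n → SV N) (G : Fin m → SV N) → Dec (Compatible s F G)
compatible? done      F G = yes tt
compatible? (left s)  F G = FinP.all? (λ r → F zero ≼[ false ]? G r) ×-dec compatible? s (F ∘ suc) G
compatible? (right s) F G = FinP.all? (λ r → G zero ≼[ true ]? F r) ×-dec compatible? s F (G ∘ suc)

compatible?-subst : ∀ {k'} (eq : k ≡ k') (s : Shuffle n m k) (F : Fin n → SV N) (G : Fin m → SV N) →
                    does (compatible? (≡.subst (Shuffle n m) eq s) F G) ≡ does (compatible? s F G)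
compatible?-subst refl s F G = refl

first-letters-exclusive : {F : Fin (suc n) → SV N} {G : Fin (suc m) → SV N} → Sorted F → Sorted G →
                          (∀ r → G zero ≼⁻ F r) ⇔ (¬ (∀ r → F zero ≼⁺ G r))
first-letters-exclusive {F = F} {G} sortedF sortedG = mk⇔
  (λ G₀≼F F₀≼G → ≼⁺⇒⋠⁻ (F₀≼G zero) (G₀≼F zero))
  (λ F₀⋠G r → ≼-key≤-trans (⋠⁺⇒≼⁻ (F₀⋠G ∘ F₀≼G₀⇒F₀≼G)) (sorted-head {F = F} sortedF r))
  where
  F₀≼G₀⇒F₀≼G : F zero ≼⁺ G zero → ∀ r → F zero ≼⁺ G r
  F₀≼G₀⇒F₀≼G F₀≼G₀ r = ≼-key≤-trans F₀≼G₀ (sorted-head {F = G} sortedG r)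

module ShuffleCount {c ℓ : Level} (R : CommutativeRing c ℓ) where
  open CommutativeRing R hiding (zero) renaming (_+_ to _⊕_; _*_ to _⊗_; refl to ≈-refl)
  open Sums R
  open import Relation.Binary.Reasoning.Setoid setoid

  []·-⊕-[not]· : ∀ b {x y z} → y ≈ x → z ≈ x → [ b ]· y ⊕ [ not b ]· z ≈ x
  []·-⊕-[not]· true  y≈x z≈x = trans (+-identityʳ _) y≈x
  []·-⊕-[not]· false y≈x z≈x = trans (+-identityˡ _) z≈x

  ∑-compatible-shuffles : ∀ n m (F : Fin n → SV N) (G : Fin m → SV N) → Sorted F → Sorted G → (x : Carrier) →
                          ∑[ s ∈ allShuffles n m ] [ does (compatible? s F G) ]· x ≈ x
  ∑-compatible-shuffles zero    zero    F G sortedF sortedG x = +-identityʳ x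
  ∑-compatible-shuffles (suc n) zero    F G sortedF sortedG x =
    trans (reflexive (∑-map (allShuffles n zero) left _))
          (∑-compatible-shuffles n zero (F ∘ suc) G (sorted-tail {F = F} sortedF) sortedG x)
  ∑-compatible-shuffles zero    (suc m) F G sortedF sortedG x =
    trans (reflexive (∑-map (allShuffles zero m) right _))
          (∑-compatible-shuffles zero m F (G ∘ suc) sortedF (sorted-tail {F = G} sortedG) x)
  ∑-compatible-shuffles (suc n) (suc m) F G sortedF sortedG x = begin
    ∑ (map left L₁ ++ map right′ L₂) Φ
      ≈⟨ ∑-++ (map left L₁) (map right′ L₂) Φ ⟩
    ∑ (map left L₁) Φ ⊕ ∑ (map right′ L₂) Φ
      ≈⟨ +-cong (reflexive (∑-map L₁ left Φ))
                (trans (reflexive (∑-map L₂ right′ Φ))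
                       (∑-cong L₂ (λ s → reflexive (≡.cong (λ b → [ b ]· x) (compatible?-subst k≡ (right s) F G))))) ⟩
    ∑[ s ∈ L₁ ] [ F₀-first ∧ does (compatible? s (F ∘ suc) G) ]· x
      ⊕ ∑[ s ∈ L₂ ] [ G₀-first ∧ does (compatible? s F (G ∘ suc)) ]· x
      ≈⟨ +-cong (∑-[]·-∧ L₁ F₀-first _ x) (∑-[]·-∧ L₂ G₀-first _ x) ⟩
    [ F₀-first ]· count₁ ⊕ [ G₀-first ]· count₂
      ≡⟨ ≡.cong (λ b → [ F₀-first ]· count₁ ⊕ [ b ]· count₂) G₀-first≡not-F₀-first ⟩
    [ F₀-first ]· count₁ ⊕ [ not F₀-first ]· count₂
      ≈⟨ []·-⊕-[not]· F₀-first
           (∑-compatible-shuffles n (suc m) (F ∘ suc) G (sorted-tail {F = F} sortedF) sortedG x)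
           (∑-compatible-shuffles (suc n) m F (G ∘ suc) sortedF (sorted-tail {F = G} sortedG) x) ⟩
    x ∎
    where
    L₁ = allShuffles n (suc m)
    L₂ = allShuffles (suc n) m
    k≡ : suc (suc n + m) ≡ suc n + suc m
    k≡ = ≡.sym (≡.cong suc (ℕP.+-suc n m))
    right′ : Shuffle (suc n) m (suc n + m) → Shuffle (suc n) (suc m) (suc n + suc m)
    right′ s = ≡.subst (Shuffle (suc n) (suc m)) k≡ (right s)
    Φ : Shuffle (suc n) (suc m) (suc n + suc m) → Carrier
    Φ s = [ does (compatible? s F G) ]· x
    count₁ count₂ : Carrier
    count₁ = ∑[ s ∈ L₁ ] [ does (compatible? s (F ∘ suc) G) ]· x
    count₂ = ∑[ s ∈ L₂ ] [ does (compatible? s F (G ∘ suc)) ]· x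
    F₀-first-dec = FinP.all? (λ r → F zero ≼[ false ]? G r)
    G₀-first-dec = FinP.all? (λ r → G zero ≼[ true ]? F r)
    F₀-first G₀-first : Bool
    F₀-first = does F₀-first-dec
    G₀-first = does G₀-first-dec
    G₀-first≡not-F₀-first : G₀-first ≡ not F₀-first
    G₀-first≡not-F₀-first =
      does-⇔ (first-letters-exclusive {F = F} {G} sortedF sortedG) G₀-first-dec (¬? F₀-first-dec)

CompatibleAt : Shuffle n m k → (Fin n → SV N) → (Fin m → SV N) → Set
CompatibleAt s F G = ∀ r r' → (unpos s (inj₁ r) Fin.< unpos s (inj₂ r') → F r ≼⁺ G r')
                            × (unpos s (inj₂ r') Fin.< unpos s (inj₁ r) → G r' ≼⁻ F r)

compatible⇒compatibleAt : (s : Shuffle n m k) {F : Fin n → SV N} {G : Fin m → SV N} →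
                          Compatible s F G → CompatibleAt s F G
compatible⇒compatibleAt (left s)  (F₀≼G , _)    zero    r' = (λ _ → F₀≼G r') , λ ()
compatible⇒compatibleAt (left s)  (_ , compat)  (suc r) r' =
  let F≼G , G≼F = compatible⇒compatibleAt s compat r r' in
  (λ { (ℕ.s≤s lt) → F≼G lt }) , (λ { (ℕ.s≤s lt) → G≼F lt })
compatible⇒compatibleAt (right s) (G₀≼F , _)    r zero     = (λ ()) , λ _ → G₀≼F r
compatible⇒compatibleAt (right s) (_ , compat)  r (suc r') =
  let F≼G , G≼F = compatible⇒compatibleAt s compat r r' in
  (λ { (ℕ.s≤s lt) → F≼G lt }) , (λ { (ℕ.s≤s lt) → G≼F lt })

compatibleAt⇒compatible : (s : Shuffle n m k) {F : Fin n → SV N} {G : Fin m → SV N} →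
                          CompatibleAt s F G → Compatible s F G
compatibleAt⇒compatible done      compat = tt
compatibleAt⇒compatible (left s)  compat =
  (λ r' → proj₁ (compat zero r') (ℕ.s≤s ℕ.z≤n)) ,
  compatibleAt⇒compatible s (λ r r' → let F≼G , G≼F = compat (suc r) r' in F≼G ∘ ℕ.s≤s , G≼F ∘ ℕ.s≤s)
compatibleAt⇒compatible (right s) compat =
  (λ r → proj₂ (compat r zero) (ℕ.s≤s ℕ.z≤n)) ,
  compatibleAt⇒compatible s (λ r r' → let F≼G , G≼F = compat r (suc r') in F≼G ∘ ℕ.s≤s , G≼F ∘ ℕ.s≤s)

<-cancel : ∀ {a b} (φ : Fin a → Fin b) → (∀ {x y} → x Fin.< y → φ x Fin.< φ y) →
           ∀ {x y} → φ x Fin.< φ y → x Fin.< y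
<-cancel φ φ-mono {x} {y} φx<φy with FinP.<-cmp x y
... | tri< x<y _ _ = x<y
... | tri≈ _ refl _ = contradiction φx<φy (ℕP.<-irrefl refl)
... | tri> _ _ y<x = contradiction φx<φy (ℕP.<-asym (φ-mono y<x))

unpos-inj₁-mono : (s : Shuffle n m k) → ∀ {r r'} → r Fin.< r' → unpos s (inj₁ r) Fin.< unpos s (inj₁ r')
unpos-inj₁-mono (left s)  {zero}  {suc r'} _            = ℕ.s≤s ℕ.z≤n
unpos-inj₁-mono (left s)  {suc r} {suc r'} (ℕ.s≤s r<r') = ℕ.s≤s (unpos-inj₁-mono s r<r')
unpos-inj₁-mono (right s)                  r<r'         = ℕ.s≤s (unpos-inj₁-mono s r<r')

unpos-inj₂-mono : (s : Shuffle n m k) → ∀ {r r'} → r Fin.< r' → unpos s (inj₂ r) Fin.< unpos s (inj₂ r')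
unpos-inj₂-mono (right s) {zero}  {suc r'} _            = ℕ.s≤s ℕ.z≤n
unpos-inj₂-mono (right s) {suc r} {suc r'} (ℕ.s≤s r<r') = ℕ.s≤s (unpos-inj₂-mono s r<r')
unpos-inj₂-mono (left s)                   r<r'         = ℕ.s≤s (unpos-inj₂-mono s r<r')

↑ˡ-mono : ∀ {i j : Fin n} → i Fin.< j → (i ↑ˡ m) Fin.< (j ↑ˡ m)
↑ˡ-mono {m = m} {i} {j} = ≡.subst₂ ℕ._<_ (≡.sym (FinP.toℕ-↑ˡ i m)) (≡.sym (FinP.toℕ-↑ˡ j m))

↑ʳ-mono : ∀ {i j : Fin m} → i Fin.< j → (n ↑ʳ i) Fin.< (n ↑ʳ j)
↑ʳ-mono {n = n} {i = i} {j} i<j =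
  ≡.subst₂ ℕ._<_ (≡.sym (FinP.toℕ-↑ʳ n i)) (≡.sym (FinP.toℕ-↑ʳ n j)) (ℕP.+-monoʳ-< n i<j)

↑ˡ<↑ʳ : (i : Fin n) (j : Fin m) → (i ↑ˡ m) Fin.< (n ↑ʳ j)
↑ˡ<↑ʳ {n = n} {m = m} i j = ≡.subst₂ ℕ._<_ (≡.sym (FinP.toℕ-↑ˡ i m)) (≡.sym (FinP.toℕ-↑ʳ n j))
                              (ℕP.<-≤-trans (FinP.toℕ<n i) (ℕP.m≤m+n n (Fin.toℕ j)))

EnrichedCond-transport : ∀ {a b} {P : Fin a → Fin a → Set} {Q : Fin b → Fin b → Set}
                         {f : Fin a → SV N} {g : Fin b → SV N} {i j : Fin a} {i' j' : Fin b} →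
                         (Q i' j' → P i j) → (i' Fin.< j' → i Fin.< j) → (j' Fin.< i' → j Fin.< i) →
                         f i ≡ g i' → f j ≡ g j' → EnrichedCond P f i j → EnrichedCond Q g i' j'
EnrichedCond-transport Q⇒P <⇒< >⇒> fi≡gi' fj≡gj' cond q =
  (λ i'<j' → ≡.subst₂ _≼⁺_ fi≡gi' fj≡gj' (proj₁ (cond (Q⇒P q)) (<⇒< i'<j'))) ,
  (λ j'<i' → ≡.subst₂ _≼⁻_ fi≡gi' fj≡gj' (proj₂ (cond (Q⇒P q)) (>⇒> j'<i')))

IsEnriched-resp : ∀ {k} {_<P_ : Fin k → Fin k → Set} {h h' : Fin k → SV N} →
                  (∀ i → h i ≡ h' i) → IsEnriched _<P_ h → IsEnriched _<P_ h'
IsEnriched-resp {_<P_ = _<P_} h≗h' enriched i j =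
  EnrichedCond-transport {P = _<P_} {_<P_} id id id (h≗h' i) (h≗h' j) (enriched i j)

enriched⇒sorted : (π : Permutation′ n) (f : Fin n → SV N) →
                  IsEnriched (_<[ π ]_) f → Sorted (f ∘ (π ⟨$⟩ʳ_))
enriched⇒sorted π f enriched {r} {r'} r<r'
  with FinP.<-cmp (π ⟨$⟩ʳ r) (π ⟨$⟩ʳ r')
     | enriched _ _ (≡.subst₂ Fin._<_ (≡.sym (inverseˡ π)) (≡.sym (inverseˡ π)) r<r')
... | tri< i<j _ _ | cond = ≼⇒key≤ (proj₁ cond i<j)
... | tri> _ _ j<i | cond = ≼⇒key≤ (proj₂ cond j<i)
... | tri≈ _ i≡j _ | _    = ℕP.≤-reflexive (≡.cong (key ∘ f) i≡j)

module CoshuffleVertices {n m : ℕ} (π : Permutation′ n) (σ : Permutation′ m) (s : Shuffle n m (n + m)) where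

  τ : Permutation′ (n + m)
  τ = coshufflePerm π σ s

  τ⁻¹-↑ˡ : ∀ i → τ ⟨$⟩ˡ (i ↑ˡ m) ≡ unpos s (inj₁ (π ⟨$⟩ˡ i))
  τ⁻¹-↑ˡ i rewrite FinP.splitAt-↑ˡ n i m = refl

  τ⁻¹-↑ʳ : ∀ j → τ ⟨$⟩ˡ (n ↑ʳ j) ≡ unpos s (inj₂ (σ ⟨$⟩ˡ j))
  τ⁻¹-↑ʳ j rewrite FinP.splitAt-↑ʳ n m j = refl

  ↑ˡ-<τ⇔ : ∀ {i j} → (i ↑ˡ m) <[ τ ] (j ↑ˡ m) ⇔ i <[ π ] j
  ↑ˡ-<τ⇔ {i} {j} = mk⇔
    (<-cancel (unpos s ∘ inj₁) (unpos-inj₁-mono s) ∘ ≡.subst₂ Fin._<_ (τ⁻¹-↑ˡ i) (τ⁻¹-↑ˡ j))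
    (≡.subst₂ Fin._<_ (≡.sym (τ⁻¹-↑ˡ i)) (≡.sym (τ⁻¹-↑ˡ j)) ∘ unpos-inj₁-mono s)

  ↑ʳ-<τ⇔ : ∀ {i j} → (n ↑ʳ i) <[ τ ] (n ↑ʳ j) ⇔ i <[ σ ] j
  ↑ʳ-<τ⇔ {i} {j} = mk⇔
    (<-cancel (unpos s ∘ inj₂) (unpos-inj₂-mono s) ∘ ≡.subst₂ Fin._<_ (τ⁻¹-↑ʳ i) (τ⁻¹-↑ʳ j))
    (≡.subst₂ Fin._<_ (≡.sym (τ⁻¹-↑ʳ i)) (≡.sym (τ⁻¹-↑ʳ j)) ∘ unpos-inj₂-mono s)

  coshuffleComp-↑ˡ : (α : Fin n → ℕ) (β : Fin m → ℕ) (i : Fin n) →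
                     coshuffleComp α β s (τ ⟨$⟩ˡ (i ↑ˡ m)) ≡ α (π ⟨$⟩ˡ i)
  coshuffleComp-↑ˡ α β i =
    ≡.trans (≡.cong (λ p → [ α , β ]′ (pos s p)) (τ⁻¹-↑ˡ i)) (≡.cong [ α , β ]′ (pos-unpos s _))

  coshuffleComp-↑ʳ : (α : Fin n → ℕ) (β : Fin m → ℕ) (j : Fin m) →
                     coshuffleComp α β s (τ ⟨$⟩ˡ (n ↑ʳ j)) ≡ β (σ ⟨$⟩ˡ j)
  coshuffleComp-↑ʳ α β j =
    ≡.trans (≡.cong (λ p → [ α , β ]′ (pos s p)) (τ⁻¹-↑ʳ j)) (≡.cong [ α , β ]′ (pos-unpos s _))

  module _ {N : ℕ} (f : Fin n → SV N) (g : Fin m → SV N) where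

    private
      F : Fin n → SV N
      F = f ∘ (π ⟨$⟩ʳ_)
      G : Fin m → SV N
      G = g ∘ (σ ⟨$⟩ʳ_)
      F-π⁻¹ : ∀ i → F (π ⟨$⟩ˡ i) ≡ (f VF.++ g) (i ↑ˡ m)
      F-π⁻¹ i = ≡.trans (≡.cong f (inverseʳ π)) (≡.sym (VFP.lookup-++ˡ f g i))
      G-σ⁻¹ : ∀ j → G (σ ⟨$⟩ˡ j) ≡ (f VF.++ g) (n ↑ʳ j)
      G-σ⁻¹ j = ≡.trans (≡.cong g (inverseʳ σ)) (≡.sym (VFP.lookup-++ʳ f g j))
      τ⁻¹-π : ∀ r → τ ⟨$⟩ˡ ((π ⟨$⟩ʳ r) ↑ˡ m) ≡ unpos s (inj₁ r)
      τ⁻¹-π r = ≡.trans (τ⁻¹-↑ˡ _) (≡.cong (unpos s ∘ inj₁) (inverseˡ π))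
      τ⁻¹-σ : ∀ r → τ ⟨$⟩ˡ (n ↑ʳ (σ ⟨$⟩ʳ r)) ≡ unpos s (inj₂ r)
      τ⁻¹-σ r = ≡.trans (τ⁻¹-↑ʳ _) (≡.cong (unpos s ∘ inj₂) (inverseˡ σ))

    enriched-++⇒ : IsEnriched (_<[ τ ]_) (f VF.++ g) →
                   IsEnriched (_<[ π ]_) f × IsEnriched (_<[ σ ]_) g × CompatibleAt s F G
    enriched-++⇒ enriched =
      (λ i j → EnrichedCond-transport {P = _<[ τ ]_} {_<[ π ]_} {f VF.++ g} {f}
                 (Equivalence.from ↑ˡ-<τ⇔) ↑ˡ-mono ↑ˡ-mono
                 (VFP.lookup-++ˡ f g i) (VFP.lookup-++ˡ f g j) (enriched (i ↑ˡ m) (j ↑ˡ m))) ,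
      (λ i j → EnrichedCond-transport {P = _<[ τ ]_} {_<[ σ ]_} {f VF.++ g} {g}
                 (Equivalence.from ↑ʳ-<τ⇔) ↑ʳ-mono ↑ʳ-mono
                 (VFP.lookup-++ʳ f g i) (VFP.lookup-++ʳ f g j) (enriched (n ↑ʳ i) (n ↑ʳ j))) ,
      λ r r' →
        (λ lt → ≡.subst₂ _≼⁺_ (VFP.lookup-++ˡ f g _) (VFP.lookup-++ʳ f g _)
                  (proj₁ (enriched _ _ (≡.subst₂ Fin._<_ (≡.sym (τ⁻¹-π r)) (≡.sym (τ⁻¹-σ r')) lt)) (↑ˡ<↑ʳ _ _))) ,
        (λ lt → ≡.subst₂ _≼⁻_ (VFP.lookup-++ʳ f g _) (VFP.lookup-++ˡ f g _)
                  (proj₂ (enriched _ _ (≡.subst₂ Fin._<_ (≡.sym (τ⁻¹-σ r')) (≡.sym (τ⁻¹-π r)) lt)) (↑ˡ<↑ʳ _ _)))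

    ⇒enriched-++ : IsEnriched (_<[ π ]_) f → IsEnriched (_<[ σ ]_) g → CompatibleAt s F G →
                   IsEnriched (_<[ τ ]_) (f VF.++ g)
    ⇒enriched-++ enrichedf enrichedg compat a b =
      ≡.subst₂ (EnrichedCond (_<[ τ ]_) (f VF.++ g)) (FinP.join-splitAt n m a) (FinP.join-splitAt n m b)
               (cond (splitAt n a) (splitAt n b))
      where
      cond : ∀ x y → EnrichedCond (_<[ τ ]_) (f VF.++ g) (join n m x) (join n m y)
      cond (inj₁ i) (inj₁ j) =
        EnrichedCond-transport {P = _<[ π ]_} {_<[ τ ]_} {f} {f VF.++ g}
          (Equivalence.to ↑ˡ-<τ⇔) (<-cancel (_↑ˡ m) ↑ˡ-mono) (<-cancel (_↑ˡ m) ↑ˡ-mono)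
          (≡.sym (VFP.lookup-++ˡ f g i)) (≡.sym (VFP.lookup-++ˡ f g j)) (enrichedf i j)
      cond (inj₂ i) (inj₂ j) =
        EnrichedCond-transport {P = _<[ σ ]_} {_<[ τ ]_} {g} {f VF.++ g}
          (Equivalence.to ↑ʳ-<τ⇔) (<-cancel (n ↑ʳ_) ↑ʳ-mono) (<-cancel (n ↑ʳ_) ↑ʳ-mono)
          (≡.sym (VFP.lookup-++ʳ f g i)) (≡.sym (VFP.lookup-++ʳ f g j)) (enrichedg i j)
      cond (inj₁ i) (inj₂ j) lt =
        (λ _ → ≡.subst₂ _≼⁺_ (F-π⁻¹ i) (G-σ⁻¹ j)
                 (proj₁ (compat (π ⟨$⟩ˡ i) (σ ⟨$⟩ˡ j)) (≡.subst₂ Fin._<_ (τ⁻¹-↑ˡ i) (τ⁻¹-↑ʳ j) lt))) ,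
        (λ b<a → contradiction b<a (ℕP.<-asym (↑ˡ<↑ʳ i j)))
      cond (inj₂ j) (inj₁ i) lt =
        (λ a<b → contradiction a<b (ℕP.<-asym (↑ˡ<↑ʳ i j))) ,
        (λ _ → ≡.subst₂ _≼⁻_ (G-σ⁻¹ j) (F-π⁻¹ i)
                 (proj₂ (compat (π ⟨$⟩ˡ i) (σ ⟨$⟩ˡ j)) (≡.subst₂ Fin._<_ (τ⁻¹-↑ʳ j) (τ⁻¹-↑ˡ i) lt)))

    does-enriched-++ : does (isEnriched? (_<[ τ ]_) (<[]? τ) (f VF.++ g))
                       ≡ does (isEnriched? (_<[ π ]_) (<[]? π) f) ∧ (does (isEnriched? (_<[ σ ]_) (<[]? σ) g)
                                                                     ∧ does (compatible? s F G))
    does-enriched-++ = does-⇔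
      (mk⇔ (λ enriched → let enrichedf , enrichedg , compat = enriched-++⇒ enriched
                          in enrichedf , enrichedg , compatibleAt⇒compatible s compat)
           (λ (enrichedf , enrichedg , compat) → ⇒enriched-++ enrichedf enrichedg (compatible⇒compatibleAt s compat)))
      (isEnriched? (_<[ τ ]_) (<[]? τ) (f VF.++ g))
      (isEnriched? (_<[ π ]_) (<[]? π) f ×-dec (isEnriched? (_<[ σ ]_) (<[]? σ) g ×-dec compatible? s F G))

module GammaTerms {c ℓ : Level} (R : CommutativeRing c ℓ) (q : CommutativeRing.Carrier R) where
  open CommutativeRing R hiding (zero) renaming (_+_ to _⊕_; _*_ to _⊗_; refl to ≈-refl)
  open Sums R

  term : ∀ {k} (_<P_ : Fin k → Fin k → Set) → (∀ i j → Dec (i <P j)) → (Fin k → ℕ) →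
         Vec ℕ N → (Fin k → SV N) → Carrier
  term _<P_ _<P?_ ε e h =
    [ does (isEnriched? _<P_ _<P?_ h) ]· [ does (expo R ε h ≟ᵥ e) ]· powR R q (negCount R h)

  module _ {k : ℕ} (_<P_ : Fin k → Fin k → Set) (_<P?_ : ∀ i j → Dec (i <P j)) (ε : Fin k → ℕ) where

    -- Γq's summand is built from a conjunction local to its definition, so it is named here by unification.
    private mutual
      summand : Vec ℕ N → (Fin k → SV N) → Carrier
      summand = _

      Γq≡∑summand : (e : Vec ℕ N) → Γq R q _<P_ _<P?_ ε N e ≡ ∑ (allFuns (allSV N) k) (summand e)
      Γq≡∑summand e = refl

    private
      summand≈term : (e : Vec ℕ N) (h : Fin k → SV N) → summand e h ≈ term _<P_ _<P?_ ε e h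
      summand≈term e h with does (isEnriched? _<P_ _<P?_ h)
      ... | true  = ≈-refl
      ... | false = ≈-refl

    Γq≈∑term : (e : Vec ℕ N) → Γq R q _<P_ _<P?_ ε N e ≈ ∑ (allFuns (allSV N) k) (term _<P_ _<P?_ ε e)
    Γq≈∑term {N} e = trans (reflexive (Γq≡∑summand e)) (∑-cong (allFuns (allSV N) k) (summand≈term e))

  powR-+ : ∀ a b → powR R q (a + b) ≈ powR R q a ⊗ powR R q b
  powR-+ zero    b = sym (*-identityˡ _)
  powR-+ (suc a) b = trans (*-congˡ (powR-+ a b)) (sym (*-assoc _ _ _))

  expo-cong : ∀ {k} (ε : Fin k → ℕ) {h h' : Fin k → SV N} → (∀ i → h i ≡ h' i) → expo R ε h ≡ expo R ε h'
  expo-cong {k = k} ε h≗h' = VecP.tabulate-cong λ x →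
    sumFinℕ-cong k (λ i → ≡.cong (λ v → if does (proj₁ v FinP.≟ x) then ε i else 0) (h≗h' i))

  negCount-cong : ∀ {k} {h h' : Fin k → SV N} → (∀ i → h i ≡ h' i) → negCount R h ≡ negCount R h'
  negCount-cong {k = k} h≗h' = sumFinℕ-cong k (λ i → ≡.cong (λ v → if isNeg v then 1 else 0) (h≗h' i))

  term-cong : ∀ {k} (_<P_ : Fin k → Fin k → Set) (_<P?_ : ∀ i j → Dec (i <P j)) (ε : Fin k → ℕ) (e : Vec ℕ N)
              {h h' : Fin k → SV N} → (∀ i → h i ≡ h' i) → term _<P_ _<P?_ ε e h ≡ term _<P_ _<P?_ ε e h'
  term-cong _<P_ _<P?_ ε e {h} {h'} h≗h' = ≡.cong₂ [_]·_
    (does-⇔ (mk⇔ (IsEnriched-resp h≗h') (IsEnriched-resp (≡.sym ∘ h≗h')))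
            (isEnriched? _<P_ _<P?_ h) (isEnriched? _<P_ _<P?_ h'))
    (≡.cong₂ (λ v x → [ does (v ≟ᵥ e) ]· x) (expo-cong ε h≗h') (≡.cong (powR R q) (negCount-cong h≗h')))

  expo-++ : ∀ {n m} (ε : Fin (n + m) → ℕ) (ε₁ : Fin n → ℕ) (ε₂ : Fin m → ℕ) →
            (∀ i → ε (i ↑ˡ m) ≡ ε₁ i) → (∀ j → ε (n ↑ʳ j) ≡ ε₂ j) →
            (f : Fin n → SV N) (g : Fin m → SV N) → expo R ε (f VF.++ g) ≡ expo R ε₁ f +ᵥ expo R ε₂ g
  expo-++ {n = n} {m} ε ε₁ ε₂ ε≗ε₁ ε≗ε₂ f g =
    ≡.sym (≡.trans (zipWith-+-tabulate _ _) (VecP.tabulate-cong λ x →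
      ≡.sym (≡.trans (sumFinℕ-++ n m _) (≡.cong₂ _+_
        (sumFinℕ-cong n (λ i → ≡.cong₂ (weightAt x) (VFP.lookup-++ˡ f g i) (ε≗ε₁ i)))
        (sumFinℕ-cong m (λ j → ≡.cong₂ (weightAt x) (VFP.lookup-++ʳ f g j) (ε≗ε₂ j)))))))
    where
    weightAt : Fin N → SV N → ℕ → ℕ
    weightAt x v w = if does (proj₁ v FinP.≟ x) then w else 0

  negCount-++ : ∀ {n m} (f : Fin n → SV N) (g : Fin m → SV N) → negCount R (f VF.++ g) ≡ negCount R f + negCount R g
  negCount-++ {n = n} {m} f g = ≡.trans (sumFinℕ-++ n m _) (≡.cong₂ _+_
    (sumFinℕ-cong n (λ i → ≡.cong (λ v → if isNeg v then 1 else 0) (VFP.lookup-++ˡ f g i)))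
    (sumFinℕ-cong m (λ j → ≡.cong (λ v → if isNeg v then 1 else 0) (VFP.lookup-++ʳ f g j))))

module ProductFormula {c ℓ : Level} (R : CommutativeRing c ℓ) (q : CommutativeRing.Carrier R)
                      {n m : ℕ} (π : Permutation′ n) (σ : Permutation′ m) (α : Fin n → ℕ) (β : Fin m → ℕ)
                      {N : ℕ} (e : Vec ℕ N) where
  open CommutativeRing R hiding (zero) renaming (_+_ to _⊕_; _*_ to _⊗_; refl to ≈-refl)
  open Sums R
  open GammaTerms R q
  open ShuffleCount R
  open import Relation.Binary.Reasoning.Setoid setoid

  private
    Fs : List (Fin n → SV N)
    Fs = allFuns (allSV N) n
    Gs : List (Fin m → SV N)
    Gs = allFuns (allSV N) m
    Ss : List (Shuffle n m (n + m))
    Ss = allShuffles n m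
    απ : Fin n → ℕ
    απ i = α (π ⟨$⟩ˡ i)
    βσ : Fin m → ℕ
    βσ j = β (σ ⟨$⟩ˡ j)
    enrichedπ? : (f : Fin n → SV N) → Dec (IsEnriched (_<[ π ]_) f)
    enrichedπ? = isEnriched? (_<[ π ]_) (<[]? π)
    enrichedσ? : (g : Fin m → SV N) → Dec (IsEnriched (_<[ σ ]_) g)
    enrichedσ? = isEnriched? (_<[ σ ]_) (<[]? σ)
    termπ : Vec ℕ N → (Fin n → SV N) → Carrier
    termπ = term (_<[ π ]_) (<[]? π) απ
    termσ : Vec ℕ N → (Fin m → SV N) → Carrier
    termσ = term (_<[ σ ]_) (<[]? σ) βσ
    τ : Shuffle n m (n + m) → Permutation′ (n + m)
    τ = coshufflePerm π σ
    termτ : Shuffle n m (n + m) → (Fin (n + m) → SV N) → Carrier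
    termτ s = term (_<[ τ s ]_) (<[]? (τ s)) (λ a → coshuffleComp α β s (τ s ⟨$⟩ˡ a)) e
    weight : (Fin n → SV N) → (Fin m → SV N) → Carrier
    weight f g = [ does (expo R απ f +ᵥ expo R βσ g ≟ᵥ e) ]· powR R q (negCount R f + negCount R g)

  pairTerm : (Fin n → SV N) → (Fin m → SV N) → Carrier
  pairTerm f g = [ does (enrichedπ? f) ∧ does (enrichedσ? g) ]· [ does (expo R απ f +ᵥ expo R βσ g ≟ᵥ e) ]·
                 (powR R q (negCount R f) ⊗ powR R q (negCount R g))

  ∑-splits-terms : ∀ f g → ∑[ p ∈ splits e ] (termπ (proj₁ p) f ⊗ termσ (proj₂ p) g) ≈ pairTerm f g
  ∑-splits-terms f g = begin
    ∑[ p ∈ splits e ] (termπ (proj₁ p) f ⊗ termσ (proj₂ p) g)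
      ≈⟨ ∑-cong (splits e) (λ p → trans ([]·-⊗ Ef Eg _ _) ([]·-cong (Ef ∧ Eg) ([]·-⊗ _ _ _ _))) ⟩
    ∑[ p ∈ splits e ] [ Ef ∧ Eg ]· [ does (expo R απ f ≟ᵥ proj₁ p) ∧ does (expo R βσ g ≟ᵥ proj₂ p) ]· qfg
      ≈⟨ ∑-[]· (splits e) (Ef ∧ Eg) _ ⟩
    [ Ef ∧ Eg ]· ∑[ p ∈ splits e ] [ does (expo R απ f ≟ᵥ proj₁ p) ∧ does (expo R βσ g ≟ᵥ proj₂ p) ]· qfg
      ≈⟨ []·-cong (Ef ∧ Eg) (∑-splits e (expo R απ f) (expo R βσ g) qfg) ⟩
    pairTerm f g ∎
    where
    Ef = does (enrichedπ? f)
    Eg = does (enrichedσ? g)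
    qfg = powR R q (negCount R f) ⊗ powR R q (negCount R g)

  product≈∑pairTerm : _·S_ R (U R q π α) (U R q σ β) N e ≈ ∑[ f ∈ Fs ] ∑[ g ∈ Gs ] pairTerm f g
  product≈∑pairTerm = begin
    ∑[ p ∈ splits e ] (U R q π α N (proj₁ p) ⊗ U R q σ β N (proj₂ p))
      ≈⟨ ∑-cong (splits e) (λ p → *-cong (Γq≈∑term _ (<[]? π) απ (proj₁ p))
                                          (Γq≈∑term _ (<[]? σ) βσ (proj₂ p))) ⟩
    ∑[ p ∈ splits e ] (∑ Fs (termπ (proj₁ p)) ⊗ ∑ Gs (termσ (proj₂ p)))
      ≈⟨ ∑-cong (splits e) (λ p → trans (∑-distribʳ Fs _ _) (∑-cong Fs (λ f → ∑-distribˡ Gs _ _))) ⟩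
    ∑[ p ∈ splits e ] ∑[ f ∈ Fs ] ∑[ g ∈ Gs ] (termπ (proj₁ p) f ⊗ termσ (proj₂ p) g)
      ≈⟨ ∑-comm (splits e) Fs _ ⟩
    ∑[ f ∈ Fs ] ∑[ p ∈ splits e ] ∑[ g ∈ Gs ] (termπ (proj₁ p) f ⊗ termσ (proj₂ p) g)
      ≈⟨ ∑-cong Fs (λ f → ∑-comm (splits e) Gs _) ⟩
    ∑[ f ∈ Fs ] ∑[ g ∈ Gs ] ∑[ p ∈ splits e ] (termπ (proj₁ p) f ⊗ termσ (proj₂ p) g)
      ≈⟨ ∑-cong Fs (λ f → ∑-cong Gs (∑-splits-terms f)) ⟩
    ∑[ f ∈ Fs ] ∑[ g ∈ Gs ] pairTerm f g ∎

  termτ-++ : ∀ s f g → termτ s (f VF.++ g) ≡ [ does (enrichedπ? f) ∧ (does (enrichedσ? g)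
                                                ∧ does (compatible? s (f ∘ (π ⟨$⟩ʳ_)) (g ∘ (σ ⟨$⟩ʳ_)))) ]· weight f g
  termτ-++ s f g = ≡.cong₂ [_]·_ (does-enriched-++ f g)
    (≡.cong₂ (λ v y → [ does (v ≟ᵥ e) ]· y)
      (expo-++ _ απ βσ (coshuffleComp-↑ˡ α β) (coshuffleComp-↑ʳ α β) f g)
      (≡.cong (powR R q) (negCount-++ f g)))
    where open CoshuffleVertices π σ s

  ∑-coshuffle-terms : ∀ f g → ∑[ s ∈ Ss ] termτ s (f VF.++ g) ≈ pairTerm f g
  ∑-coshuffle-terms f g = begin
    ∑[ s ∈ Ss ] termτ s (f VF.++ g)
      ≈⟨ ∑-cong Ss (λ s → reflexive (termτ-++ s f g)) ⟩
    ∑[ s ∈ Ss ] [ Ef ∧ (Eg ∧ does (compatible? s F G)) ]· weight f g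
      ≈⟨ ∑-cong Ss (λ s → reflexive (≡.trans (≡.cong (λ b → [ b ]· weight f g) (≡.sym (BoolP.∧-assoc Ef Eg _)))
                                             ([]·-∧ (Ef ∧ Eg) _ (weight f g)))) ⟩
    ∑[ s ∈ Ss ] [ Ef ∧ Eg ]· [ does (compatible? s F G) ]· weight f g
      ≈⟨ ∑-[]· Ss (Ef ∧ Eg) _ ⟩
    [ Ef ∧ Eg ]· ∑[ s ∈ Ss ] [ does (compatible? s F G) ]· weight f g
      ≈⟨ []·-cong-dec (enrichedπ? f ×-dec enrichedσ? g) (λ (enrichedf , enrichedg) →
           ∑-compatible-shuffles n m F G (enriched⇒sorted π f enrichedf) (enriched⇒sorted σ g enrichedg) (weight f g)) ⟩
    [ Ef ∧ Eg ]· weight f g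
      ≈⟨ []·-cong (Ef ∧ Eg) ([]·-cong (does (expo R απ f +ᵥ expo R βσ g ≟ᵥ e))
                                      (powR-+ (negCount R f) (negCount R g))) ⟩
    pairTerm f g ∎
    where
    F = f ∘ (π ⟨$⟩ʳ_)
    G = g ∘ (σ ⟨$⟩ʳ_)
    Ef = does (enrichedπ? f)
    Eg = does (enrichedσ? g)

  ∑coshuffles≈∑pairTerm : sumR R (map (λ τγ → U R q (proj₁ τγ) (proj₂ τγ) N e) (Coshuffle π α σ β))
                        ≈ ∑[ f ∈ Fs ] ∑[ g ∈ Gs ] pairTerm f g
  ∑coshuffles≈∑pairTerm = begin
    ∑ (map (λ s → τ s , coshuffleComp α β s) Ss) (λ τγ → U R q (proj₁ τγ) (proj₂ τγ) N e)
      ≡⟨ ∑-map Ss _ _ ⟩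
    ∑[ s ∈ Ss ] U R q (τ s) (coshuffleComp α β s) N e
      ≈⟨ ∑-cong Ss (λ s → Γq≈∑term _ (<[]? (τ s)) _ e) ⟩
    ∑[ s ∈ Ss ] ∑ (allFuns (allSV N) (n + m)) (termτ s)
      ≈⟨ ∑-cong Ss (λ s → ∑-allFuns-++ (allSV N) n m (termτ s) (reflexive ∘ term-cong _ (<[]? (τ s)) _ e)) ⟩
    ∑[ s ∈ Ss ] ∑[ f ∈ Fs ] ∑[ g ∈ Gs ] termτ s (f VF.++ g)
      ≈⟨ ∑-comm Ss Fs _ ⟩
    ∑[ f ∈ Fs ] ∑[ s ∈ Ss ] ∑[ g ∈ Gs ] termτ s (f VF.++ g)
      ≈⟨ ∑-cong Fs (λ f → ∑-comm Ss Gs _) ⟩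
    ∑[ f ∈ Fs ] ∑[ g ∈ Gs ] ∑[ s ∈ Ss ] termτ s (f VF.++ g)
      ≈⟨ ∑-cong Fs (λ f → ∑-cong Gs (∑-coshuffle-terms f)) ⟩
    ∑[ f ∈ Fs ] ∑[ g ∈ Gs ] pairTerm f g ∎

proposition2p5 : {c ℓ : Level} (R : CommutativeRing c ℓ) (q : CommutativeRing.Carrier R)
    {n m : ℕ} (π : Permutation′ n) (σ : Permutation′ m)
    (α : Fin n → ℕ) (β : Fin m → ℕ) →
    (∀ i → 0 < α i) → (∀ j → 0 < β j) →
    (N : ℕ) (e : Vec ℕ N) →
    CommutativeRing._≈_ R
      (_·S_ R (U R q π α) (U R q σ β) N e)
      (sumR R (map (λ τγ → U R q (proj₁ τγ) (proj₂ τγ) N e) (Coshuffle π α σ β)))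
proposition2p5 R q π σ α β _ _ N e = trans product≈∑pairTerm (sym ∑coshuffles≈∑pairTerm)
  where
  open CommutativeRing R using (trans; sym)
  open ProductFormula R q π σ α β e
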